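{- Let $n_1, n_2$ be positive integers with $n_1 \leq n_2$. Then $\mathsf{sr}(n_1) \leq \mathsf{sr}(n_2)$.
   Context: For $n \in \{1,2,\ldots\}$, $\mathsf{Alist}_n$ is the sequence of integer pairs produced as follows: begin with $\langle 1, n\rangle$. Given the current pair $\langle i, y_i\rangle$ with $y_i > i$, the next pair is $\langle i+1, y_{i+1}\rangle$, where $y_{i+1}$ is the smallest integer with $(i+1)y_{i+1} > i(y_i+1)$. Stop when the current pair $\langle i,y_i\rangle$ satisfies $y_i \leq i$. This process always terminates; its final pair is denoted $\langle \mathsf{sr}(n), y_{\mathsf{sr}(n)}\rangle$, and $\mathsf{sr}(n)$ is called the strange root of $n$. -}

module Defs where

open import Data.Nat using (ℕ; suc; _+_; _*_; _≤_; _<_)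
open import Data.Product using (_×_; ∃-syntax)

-- y' is the smallest natural number with (i+1) y' > i (y+1).
-- (All y-values in the process are positive, so ℕ suffices.)
IsNextY : ℕ → ℕ → ℕ → Set
IsNextY i y y' = (i * (y + 1) < suc i * y')
               × (∀ z → i * (y + 1) < suc i * z → y' ≤ z)

-- Alist n i y : the pair ⟨i , y⟩ occurs in Alist_n.
-- A step from ⟨i , y⟩ is only taken while y > i.
data Alist (n : ℕ) : ℕ → ℕ → Set where
  start : Alist n 1 n
  step  : ∀ {i y y'} → Alist n i y → i < y → IsNextY i y y' → Alist n (suc i) y'

-- IsSR n s : s is the strange root of n, i.e. the final pair ⟨s , y_s⟩
-- of Alist_n (the pair at which y_s ≤ s and the process stops).
IsSR : ℕ → ℕ → Set
IsSR n s = ∃[ y ] (Alist n s y × y ≤ s)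

{-# OPTIONS --safe #-}
module Submission where

-- The y-values of Alist_n grow with n at every index, because each is the
-- least solution of an inequality whose left side grows with the previous one.
-- If sr(n₂) < sr(n₁), then at index sr(n₂) the list for n₁ has not stopped yet,
-- so its y-value exceeds sr(n₂), while the corresponding value for n₂ is at most
-- sr(n₂); monotonicity in n is contradicted.

open import Defs
open import Data.Nat using (ℕ; suc; _+_; _*_; _≤_; _<_; s≤s; z≤n)
open import Data.Nat.Properties
  using (≤-<-trans; <-≤-trans; ≤-trans; *-monoʳ-≤; +-monoˡ-≤; <-irrefl; ≮⇒≥; m≤n⇒m<n∨m≡n)
open import Data.Product using (_×_; ∃-syntax; _,_)
open import Data.Sum using (inj₁; inj₂)
open import Relation.Binary.PropositionalEquality using (refl)
open import Relation.Nullary using (¬_)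

IsNextY-mono : ∀ {i y₁ y₂ z₁ z₂} → y₁ ≤ y₂ → IsNextY i y₁ z₁ → IsNextY i y₂ z₂ → z₁ ≤ z₂
IsNextY-mono {i} y₁≤y₂ (_ , least₁) (next₂ , _) =
  least₁ _ (≤-<-trans (*-monoʳ-≤ i (+-monoˡ-≤ 1 y₁≤y₂)) next₂)

Alist-index-pos : ∀ {n i y} → Alist n i y → 1 ≤ i
Alist-index-pos start        = s≤s z≤n
Alist-index-pos (step _ _ _) = s≤s z≤n

Alist-mono : ∀ {n₁ n₂ i y₁ y₂} → n₁ ≤ n₂ → Alist n₁ i y₁ → Alist n₂ i y₂ → y₁ ≤ y₂
Alist-mono n₁≤n₂ start         start         = n₁≤n₂
Alist-mono n₁≤n₂ start         (step () _ _)
Alist-mono n₁≤n₂ (step () _ _) start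
Alist-mono n₁≤n₂ (step {i} a₁ _ next₁) (step a₂ _ next₂) =
  IsNextY-mono {i} (Alist-mono n₁≤n₂ a₁ a₂) next₁ next₂

Alist-before-end : ∀ {n s y k} → Alist n s y → 1 ≤ k → k < s → ∃[ y' ] (Alist n k y' × k < y')
Alist-before-end start 1≤k (s≤s k≤0) with () ← ≤-trans 1≤k k≤0
Alist-before-end (step {y = yᵢ} a i<yᵢ _) 1≤k (s≤s k≤i) with m≤n⇒m<n∨m≡n k≤i
... | inj₁ k<i  = Alist-before-end a 1≤k k<i
... | inj₂ refl = yᵢ , a , i<yᵢ

lemma2p4 : ∀ (n₁ n₂ s₁ s₂ : ℕ) → 1 ≤ n₁ → n₁ ≤ n₂ →
             IsSR n₁ s₁ → IsSR n₂ s₂ → s₁ ≤ s₂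
lemma2p4 n₁ n₂ s₁ s₂ _ n₁≤n₂ (_ , a₁ , _) (y₂ , a₂ , y₂≤s₂) = ≮⇒≥ s₂≮s₁
  where
  s₂≮s₁ : ¬ (s₂ < s₁)
  s₂≮s₁ s₂<s₁ with Alist-before-end a₁ (Alist-index-pos a₂) s₂<s₁
  ... | y , a , s₂<y = <-irrefl refl (<-≤-trans s₂<y (≤-trans (Alist-mono n₁≤n₂ a a₂) y₂≤s₂))
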